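{- Let $P$ be a $\Sigma$-pattern with first symbol in $\Sigma$, with exactly one gap, of prime length $p$, such that $\mathrm{T}(P)$ is completely additive and not the constant zero sequence. Let $g$ be a primitive root modulo $p$ (with $g=1$ if $p=2$). Then $P=(\lambda_{p,g}\cdot P(g))\,\rho_d$ for some $d\in\Sigma$, where $P(g)$ is the $g$-th letter of $P$.
   Context: $\Sigma=\mathbb{Z}/k\mathbb{Z}$ is a fixed finite cyclic group. Gaps are elements of $\mathrm{S}_\Sigma$, the bijections of $\Sigma$; $\rho_d$ is $x\mapsto x+d$, $?$ the identity. A $\Sigma$-pattern is a nonempty word over $\Sigma\cup\mathrm{S}_\Sigma$, indexed $P(1)\dots P(|P|)$. For words $x,y$: $(a\,x)\langle y\rangle=a\,x\langle y\rangle$, $(f\,x)\langle b\,y\rangle=f(b)\,x\langle y\rangle$, $(f\,x)\langle g\,y\rangle=(f\circ g)\,x\langle y\rangle$. For $P$ with first symbol in $\Sigma$: $T_0=?^\omega$, $T_{i+1}=P^\omega\langle T_i\rangle$, $\mathrm{T}(P)=\lim_iT_i$, indexed by positive integers. Completely additive: $\sigma(1)=0$, $\sigma(nm)=\sigma(n)+\sigma(m)$. For a word $w=w_1\dots w_r$ over $\{0,1,\dots\}$ and $c\in\Sigma$, $w\cdot c=(w_1c)\dots(w_rc)$ with $jc=c+\dots+c$ ($j$ times). For odd prime $p$ and primitive root $g$, $\lambda_{p,g}=\log_g(1)\log_g(2)\cdots\log_g(p-1)$ with $\log_g(a)\in\{0,\dots,p-2\}$ the discrete logarithm; $\lambda_{2,1}=0$.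 Convention: if $\mathrm{T}(P)$ is not surjective onto $\Sigma$, a gap in $P$ is identified with every bijection agreeing with it on the letters occurring in $\mathrm{T}(P)$; equality of patterns is modulo this identification. -}

module Defs where

open import Data.Nat using (ℕ; zero; suc; _+_; _*_; _∸_; _^_; _≤_; _<_; NonZero)
open import Data.Nat.DivMod using (_mod_; _%_)
open import Data.Nat.Primality using (Prime)
open import Data.Fin using (Fin; toℕ)
open import Data.Fin.Permutation using (Permutation′; _⟨$⟩ʳ_; _∘ₚ_; id)
open import Data.Vec using (Vec; lookup; []; _∷_)
open import Data.Maybe using (Maybe; just; nothing)
open import Data.Product using (∃; ∃-syntax; _×_; Σ-syntax)
open import Data.Bool using (Bool; true; false; if_then_else_)
open import Data.Nat using (_≡ᵇ_)
open import Relation.Binary.PropositionalEquality using (_≡_; _≢_)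

-- The alphabet Σ = ℤ/kℤ, represented as Fin k with addition mod k.

module _ (k : ℕ) .{{_ : NonZero k}} where

  _+Σ_ : Fin k → Fin k → Fin k
  a +Σ b = (toℕ a + toℕ b) mod k

  0Σ : Fin k
  0Σ = 0 mod k

  _·Σ_ : ℕ → Fin k → Fin k
  zero  ·Σ c = 0Σ
  suc j ·Σ c = c +Σ (j ·Σ c)

data Sym (k : ℕ) : Set where
  letter : Fin k → Sym k
  gap    : Permutation′ k → Sym k

-- f applied to a symbol, as in the insertion rules:
-- (f x)⟨b y⟩ = f(b) x⟨y⟩,  (f x)⟨g y⟩ = (f ∘ g) x⟨y⟩
act : ∀ {k} → Permutation′ k → Sym k → Sym k
act f (letter b) = letter (f ⟨$⟩ʳ b)
act f (gap h)    = gap (h ∘ₚ f)     -- h ∘ₚ f  is  x ↦ f (h x),  i.e. f ∘ h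

-- Infinite words over Sym k, indexed from 0 (index i = position i+1).
Word : ℕ → Set
Word k = ℕ → Sym k

isGap : ∀ {k} → Sym k → ℕ
isGap (letter _) = 0
isGap (gap _)    = 1

gapsBefore : ∀ {k} → Word k → ℕ → ℕ
gapsBefore x zero    = 0
gapsBefore x (suc i) = gapsBefore x i + isGap (x i)

-- the insertion x⟨y⟩ : the j-th gap of x (0-based) is filled with y(j)
fill : ∀ {k} → Word k → Word k → Word k
fill x y i with x i
... | letter a = letter a
... | gap f    = act f (y (gapsBefore x i))

periodic : ∀ {k n} → Vec (Sym k) (suc n) → Word k
periodic {n = n} P i = lookup P (i mod suc n)

Titer : ∀ {k n} → Vec (Sym k) (suc n) → ℕ → Word k
Titer P zero    = λ _ → gap id
Titer P (suc i) = fill (periodic P) (Titer P i)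

-- "T(P) = σ": σ (indexed by positive integers) is the pointwise limit of the T_i
-- (Σ ∪ S_Σ discrete): position m of T_i is eventually the letter σ(m).
IsToeplitzWord : ∀ {k n} → Vec (Sym k) (suc n) → (ℕ → Fin k) → Set
IsToeplitzWord P σ =
  ∀ m → 1 ≤ m → ∃[ i₀ ] (∀ i → i₀ ≤ i → Titer P i (m ∸ 1) ≡ letter (σ m))

CompletelyAdditive : (k : ℕ) .{{_ : NonZero k}} → (ℕ → Fin k) → Set
CompletelyAdditive k σ =
  σ 1 ≡ 0Σ k × (∀ n m → 1 ≤ n → 1 ≤ m → σ (n * m) ≡ _+Σ_ k (σ n) (σ m))

gapCount : ∀ {k n} → Vec (Sym k) n → ℕ
gapCount []       = 0
gapCount (s ∷ P)  = isGap s + gapCount P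

-- 1-based access P(i); nothing if out of range
at : ∀ {k n} → Vec (Sym k) n → ℕ → Maybe (Sym k)
at []      _             = nothing
at (s ∷ P) zero          = nothing
at (s ∷ P) (suc zero)    = just s
at (s ∷ P) (suc (suc i)) = at P (suc i)

IsPrimitiveRoot : (p : ℕ) .{{_ : NonZero p}} → ℕ → Set
IsPrimitiveRoot p g =
  1 ≤ g × g < p × (∀ j → 1 ≤ j → j < p ∸ 1 → (g ^ j) % p ≢ 1)

-- discrete logarithm log_g(a) ∈ {0, ..., p-2}: least e < p-1 with g^e ≡ a (mod p)
-- (returns 0 if none exists, which does not happen for a primitive root and 1 ≤ a < p)
dlogSearch : (p : ℕ) .{{_ : NonZero p}} (g a fuel e : ℕ) → ℕ
dlogSearch p g a zero       e = 0
dlogSearch p g a (suc fuel) e =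
  if ((g ^ e) % p) ≡ᵇ (a % p) then e else dlogSearch p g a fuel (suc e)

dlog : (p : ℕ) .{{_ : NonZero p}} (g a : ℕ) → ℕ
dlog p g a = dlogSearch p g a (p ∸ 1) 0

module Submission where

-- Since σ = T(P) reads itself off P^ω, the letters of P are the values
-- σ(1), …, σ(p-1), and position p·m of P^ω holds P's last symbol.  If that symbol
-- were a letter a, then σ(p) + σ(m) = σ(pm) = a = σ(p) would force σ = 0; so it
-- is the unique gap f, and the m-th gap of P^ω (at position pm) is filled with
-- σ(m): f(σ(m)) = σ(pm) = σ(m) + σ(p), i.e. f translates by d = σ(p).  Off the
-- multiples of p, σ depends only on the residue mod p; writing 1 ≤ i < p as
-- i ≡ g^log_g(i) gives P(i) = σ(i) = σ(g^log_g(i)) = log_g(i)·σ(g).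

open import Defs
open import Data.Nat using (ℕ; zero; suc; _+_; _*_; _∸_; _^_; _≤_; _<_; _≡ᵇ_; NonZero; nonTrivial⇒n>1; >-nonZero; >-nonZero⁻¹; z≤n; s≤s; s<s⁻¹)
open import Data.Nat.Properties
open import Data.Nat.DivMod
open import Data.Nat.Divisibility
open import Data.Nat.Primality using (Prime; euclidsLemma; prime⇒nonTrivial)
open import Data.Nat.Tactic.RingSolver using (solve-∀)
open import Data.Fin using (Fin; toℕ; fromℕ; fromℕ<; punchOut) renaming (zero to fzero; suc to fsuc)
open import Data.Fin.Properties using (toℕ-injective; toℕ<n; toℕ-fromℕ<; toℕ-fromℕ; fromℕ-def; injective⇒≤; punchOut-injective; any?)
open import Data.Fin.Permutation using (Permutation′; _⟨$⟩ʳ_)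
open import Data.Vec using (Vec; head; lookup; _∷_)
open import Data.Maybe using (just)
open import Data.Product using (∃-syntax; _×_; _,_; proj₁; proj₂)
open import Data.Sum using ([_,_]′; inj₁; inj₂)
open import Data.Empty using (⊥-elim)
open import Data.Bool using (true; false; T)
open import Data.Unit using (tt)
open import Function.Definitions using (Injective)
open import Relation.Nullary using (¬_; yes; no)
open import Relation.Binary.PropositionalEquality
open import Relation.Binary.Definitions using (tri<; tri≈; tri>)

%-≡⇒∣∸ : ∀ p .{{_ : NonZero p}} {x y} → y ≤ x → x % p ≡ y % p → p ∣ x ∸ y
%-≡⇒∣∸ p {x} {y} y≤x x≡y = divides (x / p ∸ y / p) (begin
    x ∸ y
  ≡⟨ cong₂ _∸_ (m≡m%n+[m/n]*n x p) (m≡m%n+[m/n]*n y p) ⟩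
    (x % p + x / p * p) ∸ (y % p + y / p * p)
  ≡⟨ cong (λ r → (r + x / p * p) ∸ (y % p + y / p * p)) x≡y ⟩
    (y % p + x / p * p) ∸ (y % p + y / p * p)
  ≡⟨ [m+n]∸[m+o]≡n∸o (y % p) (x / p * p) (y / p * p) ⟩
    x / p * p ∸ y / p * p
  ≡⟨ *-distribʳ-∸ p (x / p) (y / p) ⟨
    (x / p ∸ y / p) * p ∎)
  where open ≡-Reasoning

+Σ-comm : ∀ k .{{_ : NonZero k}} (x y : Fin k) → _+Σ_ k x y ≡ _+Σ_ k y x
+Σ-comm k x y = cong (_mod k) (+-comm (toℕ x) (toℕ y))

-- In ℤ/kℤ, x + y = x forces y = 0: y is a multiple of k below k.
+Σ-cancel : ∀ k .{{_ : NonZero k}} (x y : Fin k) → _+Σ_ k x y ≡ x → y ≡ 0Σ k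
+Σ-cancel k x y x+y≡x = toℕ-injective (begin
    toℕ y            ≡⟨ m<n⇒m%n≡m (toℕ<n y) ⟨
    toℕ y % k        ≡⟨ n∣m⇒m%n≡0 (toℕ y) k k∣y ⟩
    0                ≡⟨ m<n⇒m%n≡m (>-nonZero⁻¹ k) ⟨
    0 % k            ≡⟨ toℕ-fromℕ< _ ⟨
    toℕ (0Σ k)       ∎)
  where
  open ≡-Reasoning
  sum≡x : (toℕ x + toℕ y) % k ≡ toℕ x % k
  sum≡x = trans (sym (toℕ-fromℕ< _)) (trans (cong toℕ x+y≡x) (sym (m<n⇒m%n≡m (toℕ<n x))))
  k∣y : k ∣ toℕ y
  k∣y = subst (k ∣_) (m+n∸m≡n (toℕ x) (toℕ y)) (%-≡⇒∣∸ k (m≤m+n (toℕ x) (toℕ y)) sum≡x)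

-- An injective self-map of a finite set is surjective: if t were missed,
-- punching t out would give an injection Fin m → Fin (m - 1).
injective⇒surjective : ∀ {m} (h : Fin m → Fin m) → Injective _≡_ _≡_ h → ∀ t → ∃[ e ] h e ≡ t
injective⇒surjective {suc m} h h-inj t with any? (λ e → h e Data.Fin.≟ t)
... | yes hit = hit
... | no miss = ⊥-elim (<-irrefl refl (injective⇒≤ {f = squeeze} squeeze-inj))
  where
  squeeze : Fin (suc m) → Fin m
  squeeze e = punchOut {i = t} (λ t≡he → miss (e , sym t≡he))
  squeeze-inj : Injective _≡_ _≡_ squeeze
  squeeze-inj {a} {b} eq =
    h-inj (punchOut-injective (λ t≡ha → miss (a , sym t≡ha)) (λ t≡hb → miss (b , sym t≡hb)) eq)

dlogSearch-sound : ∀ p .{{_ : NonZero p}} g a fuel e₀ →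
  (∃[ e ] (e₀ ≤ e × e < e₀ + fuel × (g ^ e) % p ≡ a % p)) →
  (g ^ dlogSearch p g a fuel e₀) % p ≡ a % p
dlogSearch-sound p g a zero e₀ (e , e₀≤e , e<e₀ , _) =
  ⊥-elim (<⇒≱ e<e₀ (subst (_≤ e) (sym (+-identityʳ e₀)) e₀≤e))
dlogSearch-sound p g a (suc fuel) e₀ (e , e₀≤e , e<end , hit) with ((g ^ e₀) % p) ≡ᵇ (a % p) in test
... | true  = ≡ᵇ⇒≡ _ _ (subst T (sym test) tt)
... | false = dlogSearch-sound p g a fuel (suc e₀) (e , e₀<e , subst (e <_) (+-suc e₀ fuel) e<end , hit)
  where
  e₀<e : suc e₀ ≤ e
  e₀<e with m≤n⇒m<n∨m≡n e₀≤e
  ... | inj₁ lt = lt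
  ... | inj₂ refl with subst T test (≡⇒≡ᵇ _ _ hit)
  ... | ()

module PrimitiveRoot (n : ℕ) (p-prime : Prime (suc n)) (g : ℕ)
                     (g-primitive : IsPrimitiveRoot (suc n) g) where

  p : ℕ
  p = suc n

  1≤g : 1 ≤ g
  1≤g = proj₁ g-primitive

  g<p : g < p
  g<p = proj₁ (proj₂ g-primitive)

  instance
    g-nonZero : NonZero g
    g-nonZero = >-nonZero 1≤g

  1<p : 1 < p
  1<p = nonTrivial⇒n>1 p {{prime⇒nonTrivial p-prime}}

  -- p divides no power of g, since it divides neither 1 nor g (1 ≤ g < p).
  p∤g^ : ∀ e → ¬ (p ∣ g ^ e)
  p∤g^ zero    p∣1 = <⇒≱ 1<p (∣⇒≤ p∣1)
  p∤g^ (suc e) p∣g^1+e with euclidsLemma g (g ^ e) p-prime p∣g^1+e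
  ... | inj₁ p∣g   = <⇒≱ g<p (∣⇒≤ p∣g)
  ... | inj₂ p∣g^e = p∤g^ e p∣g^e

  g^e%p≢0 : ∀ e → (g ^ e) % p ≢ 0
  g^e%p≢0 e r≡0 = p∤g^ e (m%n≡0⇒n∣m (g ^ e) p r≡0)

  ∣g^∸1⇒g^%≡1 : ∀ c → p ∣ g ^ c ∸ 1 → (g ^ c) % p ≡ 1
  ∣g^∸1⇒g^%≡1 c p∣g^c∸1 = begin
      (g ^ c) % p          ≡⟨ cong (_% p) (m+[n∸m]≡n (m^n>0 g c)) ⟨
      (1 + (g ^ c ∸ 1)) % p ≡⟨ %-remove-+ʳ 1 p∣g^c∸1 ⟩
      1 % p                 ≡⟨ m<n⇒m%n≡m 1<p ⟩
      1                     ∎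
    where open ≡-Reasoning

  -- g^0, …, g^(p-2) are pairwise distinct modulo p: a collision g^a ≡ g^b
  -- with a < b gives p ∣ g^a (g^(b-a) - 1), contradicting primitivity.
  powers-distinct : ∀ {a b} → a < b → b < n → (g ^ a) % p ≢ (g ^ b) % p
  powers-distinct {a} {b} a<b b<n g^a≡g^b =
    [ p∤g^ a , g^c≢1 ]′ (euclidsLemma (g ^ a) (g ^ c ∸ 1) p-prime p∣g^a*[g^c∸1])
    where
    open ≡-Reasoning
    c = b ∸ a
    g^b∸g^a : g ^ b ∸ g ^ a ≡ g ^ a * (g ^ c ∸ 1)
    g^b∸g^a = begin
      g ^ b ∸ g ^ a              ≡⟨ cong (λ e → g ^ e ∸ g ^ a) (m+[n∸m]≡n (<⇒≤ a<b)) ⟨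
      g ^ (a + c) ∸ g ^ a        ≡⟨ cong₂ _∸_ (^-distribˡ-+-* g a c) (sym (*-identityʳ (g ^ a))) ⟩
      g ^ a * g ^ c ∸ g ^ a * 1  ≡⟨ *-distribˡ-∸ (g ^ a) (g ^ c) 1 ⟨
      g ^ a * (g ^ c ∸ 1)        ∎
    p∣g^a*[g^c∸1] : p ∣ g ^ a * (g ^ c ∸ 1)
    p∣g^a*[g^c∸1] = subst (p ∣_) g^b∸g^a (%-≡⇒∣∸ p (^-monoʳ-≤ g (<⇒≤ a<b)) (sym g^a≡g^b))
    g^c≢1 : ¬ (p ∣ g ^ c ∸ 1)
    g^c≢1 p∣ = proj₂ (proj₂ g-primitive) c (m<n⇒0<n∸m a<b) (≤-<-trans (m∸n≤m b a) b<n)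
                 (∣g^∸1⇒g^%≡1 c p∣)

  -- e ↦ (g^e mod p) - 1, a self-map of Fin n (= Fin (p - 1)).
  powerIndex : Fin n → Fin n
  powerIndex e = fromℕ< (∸-monoˡ-< (m%n<n (g ^ toℕ e) p) (n≢0⇒n>0 (g^e%p≢0 (toℕ e))))

  -- (Each residue g^e mod p is nonzero, so the shifted value lies below p - 1.)
  powerIndex-residue : ∀ e → toℕ (powerIndex e) ≡ (g ^ toℕ e) % p ∸ 1
  powerIndex-residue e = toℕ-fromℕ< _

  -- Equal indices mean equal residues, since every residue is at least 1.
  powerIndex-same-residue : ∀ {a b} → powerIndex a ≡ powerIndex b →
                            (g ^ toℕ a) % p ≡ (g ^ toℕ b) % p
  powerIndex-same-residue {a} {b} ha≡hb =
    ∸-cancelʳ-≡ (n≢0⇒n>0 (g^e%p≢0 (toℕ a))) (n≢0⇒n>0 (g^e%p≢0 (toℕ b)))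
      (trans (sym (powerIndex-residue a)) (trans (cong toℕ ha≡hb) (powerIndex-residue b)))

  powerIndex-injective : Injective _≡_ _≡_ powerIndex
  powerIndex-injective {a} {b} ha≡hb with <-cmp (toℕ a) (toℕ b)
  ... | tri< a<b _ _ =
    ⊥-elim (powers-distinct a<b (toℕ<n b) (powerIndex-same-residue {a} {b} ha≡hb))
  ... | tri≈ _ a≡b _ = toℕ-injective a≡b
  ... | tri> _ _ b<a =
    ⊥-elim (powers-distinct b<a (toℕ<n a) (sym (powerIndex-same-residue {a} {b} ha≡hb)))

  powers-cover : ∀ i → 1 ≤ i → i < p → ∃[ e ] (e < n × (g ^ e) % p ≡ i)
  powers-cover i 1≤i i<p
    with injective⇒surjective powerIndex powerIndex-injective (fromℕ< (∸-monoˡ-< i<p 1≤i))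
  ... | e , he = toℕ e , toℕ<n e ,
      ∸-cancelʳ-≡ (n≢0⇒n>0 (g^e%p≢0 (toℕ e))) 1≤i
        (trans (sym (powerIndex-residue e)) (trans (cong toℕ he) (toℕ-fromℕ< _)))

  dlog-correct : ∀ i → 1 ≤ i → i < p → (g ^ dlog p g i) % p ≡ i
  dlog-correct i 1≤i i<p with powers-cover i 1≤i i<p
  ... | e , e<n , g^e≡i = trans
      (dlogSearch-sound p g i n 0 (e , z≤n , e<n , trans g^e≡i (sym (m<n⇒m%n≡m i<p))))
      (m<n⇒m%n≡m i<p)

at-lookup : ∀ {k n} (P : Vec (Sym k) n) (i : Fin n) → at P (suc (toℕ i)) ≡ just (lookup P i)
at-lookup (s ∷ P) fzero            = refl
at-lookup (s ∷ P) (fsuc fzero)     = at-lookup P fzero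
at-lookup (s ∷ P) (fsuc (fsuc i))  = at-lookup P (fsuc i)

at-position : ∀ {k n} (P : Vec (Sym k) n) (i : Fin n) {s} → toℕ i ≡ s → at P (suc s) ≡ just (lookup P i)
at-position P i refl = at-lookup P i

one-position : ∀ {k n} (P : Vec (Sym k) n) (i : Fin n) → isGap (lookup P i) ≤ gapCount P
one-position (s ∷ P) fzero    = m≤m+n (isGap s) (gapCount P)
one-position (s ∷ P) (fsuc i) = ≤-trans (one-position P i) (m≤n+m (gapCount P) (isGap s))

two-positions : ∀ {k n} (P : Vec (Sym k) n) (i j : Fin n) → i ≢ j →
                isGap (lookup P i) + isGap (lookup P j) ≤ gapCount P
two-positions (s ∷ P) fzero    fzero    i≢j = ⊥-elim (i≢j refl)
two-positions (s ∷ P) fzero    (fsuc j) _   = +-monoʳ-≤ (isGap s) (one-position P j)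
two-positions (s ∷ P) (fsuc i) fzero    _   =
  subst (_≤ isGap s + gapCount P) (+-comm (isGap s) (isGap (lookup P i)))
        (+-monoʳ-≤ (isGap s) (one-position P i))
two-positions (s ∷ P) (fsuc i) (fsuc j) i≢j =
  ≤-trans (two-positions P i j (λ i≡j → i≢j (cong fsuc i≡j))) (m≤n+m (gapCount P) (isGap s))

single-gap : ∀ {k n} (P : Vec (Sym k) n) (i j : Fin n) {f : Permutation′ k} →
             gapCount P ≡ 1 → lookup P j ≡ gap f → i ≢ j → ∃[ a ] lookup P i ≡ letter a
single-gap P i j one-gap P[j]≡f i≢j with lookup P i in P[i]
... | letter a = a , refl
... | gap h    = ⊥-elim (1+n≰n (subst (2 ≤_) one-gap
      (subst₂ (λ u v → isGap u + isGap v ≤ gapCount P) P[i] P[j]≡f (two-positions P i j i≢j))))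

letter-inj : ∀ {k} {a b : Fin k} → letter a ≡ letter b → a ≡ b
letter-inj refl = refl

fill-letter : ∀ {k} (x y : Word k) t {a} → x t ≡ letter a → fill x y t ≡ letter a
fill-letter x y t x[t]≡a rewrite x[t]≡a = refl

fill-gap : ∀ {k} (x y : Word k) t {f} → x t ≡ gap f → fill x y t ≡ act f (y (gapsBefore x t))
fill-gap x y t x[t]≡f rewrite x[t]≡f = refl

periodic-block : ∀ {k n} (P : Vec (Sym k) (suc n)) q {s} (s<p : s < suc n) →
                 periodic P (q * suc n + s) ≡ lookup P (fromℕ< s<p)
periodic-block {n = n} P q {s} s<p = cong (lookup P) (toℕ-injective (begin
    toℕ ((q * p + s) mod p) ≡⟨ toℕ-fromℕ< _ ⟩
    (q * p + s) % p         ≡⟨ cong (_% p) (+-comm (q * p) s) ⟩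
    (s + q * p) % p         ≡⟨ [m+kn]%n≡m%n s q p ⟩
    s % p                   ≡⟨ m<n⇒m%n≡m s<p ⟩
    s                       ≡⟨ toℕ-fromℕ< s<p ⟨
    toℕ (fromℕ< s<p)        ∎))
  where
  open ≡-Reasoning
  p = suc n

-- The last position of the q-th block of length p is the multiple p·(q+1).
block-end : ∀ q n → suc (q * suc n + n) ≡ suc n * suc q
block-end = solve-∀

module ToeplitzWord {k n} (P : Vec (Sym k) (suc n)) (σ : ℕ → Fin k) (T≡σ : IsToeplitzWord P σ) where

  σ-letter : ∀ t {a} → periodic P t ≡ letter a → σ (suc t) ≡ a
  σ-letter t P[t]≡a with T≡σ (suc t) (s≤s z≤n)
  ... | i , stable = letter-inj (trans (sym (stable (suc i) (n≤1+n i)))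
                                      (fill-letter (periodic P) (Titer P i) t P[t]≡a))

  σ-gap : ∀ t {f} → periodic P t ≡ gap f →
          σ (suc t) ≡ f ⟨$⟩ʳ σ (suc (gapsBefore (periodic P) t))
  σ-gap t {f} P[t]≡f with T≡σ (suc t) (s≤s z≤n) | T≡σ (suc (gapsBefore (periodic P) t)) (s≤s z≤n)
  ... | i , stable-t | i′ , stable-j = letter-inj (begin
      letter (σ (suc t))                              ≡⟨ stable-t (suc (i + i′)) (m≤n⇒m≤1+n (m≤m+n i i′)) ⟨
      fill (periodic P) (Titer P (i + i′)) t          ≡⟨ fill-gap (periodic P) (Titer P (i + i′)) t P[t]≡f ⟩
      act f (Titer P (i + i′) (gapsBefore (periodic P) t)) ≡⟨ cong (act f) (stable-j (i + i′) (m≤n+m i′ i)) ⟩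
      letter (f ⟨$⟩ʳ σ (suc (gapsBefore (periodic P) t))) ∎)
    where open ≡-Reasoning

  periodic-multiple : ∀ q → periodic P (q * suc n + n) ≡ lookup P (fromℕ n)
  periodic-multiple q = trans (periodic-block P q (n<1+n n)) (cong (lookup P) (sym (fromℕ-def n)))

  -- If P ends in a letter a then σ(p·m) = a = σ(p) for all m ≥ 1, and complete
  -- additivity forces σ(m) = 0: a nonzero completely additive T(P) needs a final gap.
  last-letter⇒σ≡0 : .{{_ : NonZero k}} → CompletelyAdditive k σ → ∀ {a} →
                    lookup P (fromℕ n) ≡ letter a → ∀ m → 1 ≤ m → σ m ≡ 0Σ k
  last-letter⇒σ≡0 (_ , additive) {a} last≡a (suc q) _ =
    +Σ-cancel k (σ (suc n)) (σ (suc q)) (begin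
      _+Σ_ k (σ (suc n)) (σ (suc q)) ≡⟨ additive (suc n) (suc q) (s≤s z≤n) (s≤s z≤n) ⟨
      σ (suc n * suc q)               ≡⟨ σ[pm]≡a q ⟩
      a                               ≡⟨ σ[pm]≡a 0 ⟨
      σ (suc n * 1)                   ≡⟨ cong σ (*-identityʳ (suc n)) ⟩
      σ (suc n)                       ∎)
    where
    open ≡-Reasoning
    σ[pm]≡a : ∀ q → σ (suc n * suc q) ≡ a
    σ[pm]≡a q = subst (λ m → σ m ≡ a) (block-end q n)
      (σ-letter (q * suc n + n) (trans (periodic-multiple q) last≡a))

  module LastGap {f : Permutation′ k} (last≡f : lookup P (fromℕ n) ≡ gap f)
                 (one-gap : gapCount P ≡ 1) where

    letter-below : ∀ {s} (s<n : s < n) → ∃[ a ] lookup P (fromℕ< (m<n⇒m<1+n s<n)) ≡ letter a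
    letter-below {s} s<n =
      single-gap P (fromℕ< (m<n⇒m<1+n s<n)) (fromℕ n) one-gap last≡f (λ s≡n → <⇒≢ s<n (begin
        s                           ≡⟨ toℕ-fromℕ< (m<n⇒m<1+n s<n) ⟨
        toℕ (fromℕ< (m<n⇒m<1+n s<n)) ≡⟨ cong toℕ s≡n ⟩
        toℕ (fromℕ n)                ≡⟨ toℕ-fromℕ n ⟩
        n                            ∎))
      where open ≡-Reasoning

    -- Each block of P^ω contains exactly one gap, at its end: before position
    -- q·p + s (s ≤ p - 1) there are exactly q gaps.
    gapsBefore-within : ∀ q → gapsBefore (periodic P) (q * suc n) ≡ q →
                        ∀ s → s ≤ n → gapsBefore (periodic P) (q * suc n + s) ≡ q
    gapsBefore-within q start zero    _   =
      trans (cong (gapsBefore (periodic P)) (+-identityʳ (q * suc n))) start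
    gapsBefore-within q start (suc s) s<n = begin
        gapsBefore (periodic P) (q * suc n + suc s)
      ≡⟨ cong (gapsBefore (periodic P)) (+-suc (q * suc n) s) ⟩
        gapsBefore (periodic P) (q * suc n + s) + isGap (periodic P (q * suc n + s))
      ≡⟨ cong₂ _+_ (gapsBefore-within q start s (<⇒≤ s<n))
                   (cong isGap (trans (periodic-block P q (m<n⇒m<1+n s<n)) (proj₂ (letter-below s<n)))) ⟩
        q + 0
      ≡⟨ +-identityʳ q ⟩
        q ∎
      where open ≡-Reasoning

    gapsBefore-start : ∀ q → gapsBefore (periodic P) (q * suc n) ≡ q
    gapsBefore-start zero    = refl
    gapsBefore-start (suc q) = begin
        gapsBefore (periodic P) (suc q * suc n)
      ≡⟨ cong (gapsBefore (periodic P)) (trans (+-comm (suc n) (q * suc n)) (+-suc (q * suc n) n)) ⟩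
        gapsBefore (periodic P) (q * suc n + n) + isGap (periodic P (q * suc n + n))
      ≡⟨ cong₂ _+_ (gapsBefore-within q (gapsBefore-start q) n ≤-refl)
                   (cong isGap (trans (periodic-multiple q) last≡f)) ⟩
        q + 1
      ≡⟨ +-comm q 1 ⟩
        suc q ∎
      where open ≡-Reasoning

    -- σ(p·(q+1)) = f(σ(q+1)): the (q+1)-th gap is filled with σ(q+1).
    σ-multiple : ∀ q → σ (suc n * suc q) ≡ f ⟨$⟩ʳ σ (suc q)
    σ-multiple q = subst (λ m → σ m ≡ f ⟨$⟩ʳ σ (suc q)) (block-end q n)
      (trans (σ-gap (q * suc n + n) (trans (periodic-multiple q) last≡f))
             (cong (λ j → f ⟨$⟩ʳ σ (suc j)) (gapsBefore-within q (gapsBefore-start q) n ≤-refl)))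

    lookup-below : ∀ {s} (s<n : s < n) → lookup P (fromℕ< (m<n⇒m<1+n s<n)) ≡ letter (σ (suc s))
    lookup-below {s} s<n with letter-below s<n
    ... | a , P[s]≡a =
      trans P[s]≡a (cong letter (sym (σ-letter s (trans (periodic-block P 0 (m<n⇒m<1+n s<n)) P[s]≡a))))

    σ-residue : ∀ q {s} → s < n → σ (suc (q * suc n + s)) ≡ σ (suc s)
    σ-residue q {s} s<n =
      σ-letter (q * suc n + s) (trans (periodic-block P q (m<n⇒m<1+n s<n)) (lookup-below s<n))

    σ-mod : ∀ x → x % suc n ≢ 0 → σ x ≡ σ (x % suc n)
    σ-mod x x%p≢0 with x % suc n in x%p | m%n<n x (suc n)
    ... | zero  | _      = ⊥-elim (x%p≢0 refl)
    ... | suc s | s<p    = trans (cong σ x≡) (σ-residue (x / suc n) (s<s⁻¹ s<p))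
      where
      x≡ : x ≡ suc (x / suc n * suc n + s)
      x≡ = trans (m≡m%n+[m/n]*n x (suc n))
                 (trans (cong (_+ x / suc n * suc n) x%p) (cong suc (+-comm s (x / suc n * suc n))))

    at-below : ∀ i → 1 ≤ i → i < suc n → at P i ≡ just (letter (σ i))
    at-below (suc s) _ 1+s<p =
      trans (at-position P _ (toℕ-fromℕ< (m<n⇒m<1+n (s<s⁻¹ 1+s<p))))
            (cong just (lookup-below (s<s⁻¹ 1+s<p)))

    at-last : at P (suc n) ≡ just (gap f)
    at-last = trans (at-position P (fromℕ n) (toℕ-fromℕ n)) (cong just last≡f)

σ-pow : ∀ k .{{_ : NonZero k}} (σ : ℕ → Fin k) → CompletelyAdditive k σ →
        ∀ g → 1 ≤ g → ∀ e → σ (g ^ e) ≡ _·Σ_ k e (σ g)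
σ-pow k σ (σ1≡0 , _) g 1≤g zero = σ1≡0
σ-pow k σ σ-additive@(_ , additive) g 1≤g (suc e) =
  trans (additive g (g ^ e) 1≤g (m^n>0 g {{>-nonZero 1≤g}} e))
        (cong (_+Σ_ k (σ g)) (σ-pow k σ σ-additive g 1≤g e))

mainTheorem7 : (k : ℕ) .{{_ : NonZero k}} (n : ℕ) (P : Vec (Sym k) (suc n)) (σ : ℕ → Fin k) (g : ℕ) →
    (∃[ a ] head P ≡ letter a) →
    gapCount P ≡ 1 →
    Prime (suc n) →
    IsToeplitzWord P σ →
    CompletelyAdditive k σ →
    (∃[ m ] (1 ≤ m × σ m ≢ 0Σ k)) →
    IsPrimitiveRoot (suc n) g →
    ∃[ c ] ∃[ d ] ∃[ f ]
      ( at P g ≡ just (letter c)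
      × (∀ i → 1 ≤ i → i < suc n → at P i ≡ just (letter (_·Σ_ k (dlog (suc n) g i) c)))
      × at P (suc n) ≡ just (gap f)
      × (∀ (x : Fin k) → (∃[ m ] (1 ≤ m × σ m ≡ x)) → f ⟨$⟩ʳ x ≡ _+Σ_ k x d) )
mainTheorem7 k n P σ g _ one-gap p-prime T≡σ σ-additive (m , 1≤m , σm≢0) g-primitive
  with lookup P (fromℕ n) in last-symbol
... | letter a = ⊥-elim (σm≢0 (ToeplitzWord.last-letter⇒σ≡0 P σ T≡σ σ-additive last-symbol m 1≤m))
... | gap f    = σ g , σ (suc n) , f , at-below g 1≤g g<p , letters-are-logs , at-last , f-translates
  where
  open ToeplitzWord P σ T≡σ
  open LastGap last-symbol one-gap
  open PrimitiveRoot n p-prime g g-primitive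

  -- P(i) = σ(i) = σ(g^log_g(i)) = log_g(i)·σ(g), since σ(i) only depends on i mod p.
  letters-are-logs : ∀ i → 1 ≤ i → i < suc n →
                     at P i ≡ just (letter (_·Σ_ k (dlog (suc n) g i) (σ g)))
  letters-are-logs i 1≤i i<p = trans (at-below i 1≤i i<p) (cong (λ c → just (letter c)) (begin
      σ i                         ≡⟨ cong σ (dlog-correct i 1≤i i<p) ⟨
      σ (g ^ ℓ % suc n)           ≡⟨ σ-mod (g ^ ℓ) (g^e%p≢0 ℓ) ⟨
      σ (g ^ ℓ)                   ≡⟨ σ-pow k σ σ-additive g 1≤g ℓ ⟩
      _·Σ_ k ℓ (σ g)              ∎))
    where
    open ≡-Reasoning
    ℓ = dlog (suc n) g i

  -- f(σ(m)) = σ(p·m) = σ(p) + σ(m): on the values of σ the gap is the shift by σ(p).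
  f-translates : ∀ x → (∃[ m ] (1 ≤ m × σ m ≡ x)) → f ⟨$⟩ʳ x ≡ _+Σ_ k x (σ (suc n))
  f-translates _ (suc q , _ , refl) = begin
      f ⟨$⟩ʳ σ (suc q)                ≡⟨ σ-multiple q ⟨
      σ (suc n * suc q)               ≡⟨ proj₂ σ-additive (suc n) (suc q) (s≤s z≤n) (s≤s z≤n) ⟩
      _+Σ_ k (σ (suc n)) (σ (suc q))  ≡⟨ +Σ-comm k (σ (suc n)) (σ (suc q)) ⟩
      _+Σ_ k (σ (suc q)) (σ (suc n))  ∎
    where open ≡-Reasoning
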